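{- For every integer $t\geq 4$, every graph that does not contain $K_t$ as a minor has a colouring with $3t-3$ colours such that for $t-1$ of the colours each monochromatic component has at most $t-4$ vertices, and the other $2t-2$ colour classes are independent sets.
   Context: All graphs are finite and simple. Colourings need not be proper; a monochromatic component is a connected component of the subgraph induced by the vertices of one colour. -}

module Defs where

open import Data.Nat using (ℕ; suc; _≤_; _∸_; _*_)
open import Data.Fin using (Fin)
open import Data.Bool using (Bool; true; false)
open import Data.Maybe using (Maybe; just)
open import Data.Sum using (_⊎_; inj₁; inj₂)
open import Data.Product using (Σ; ∃; _×_; _,_)
open import Relation.Binary.PropositionalEquality using (_≡_; _≢_)
open import Relation.Nullary using (¬_)
open import Function.Definitions using (Injective)

record Graph : Set where
  field
    n     : ℕ
    adj   : Fin n → Fin n → Bool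
    sym   : ∀ u v → adj u v ≡ adj v u
    irrefl : ∀ v → adj v v ≡ false

open Graph public

data Reach (G : Graph) (P : Fin (n G) → Set) : Fin (n G) → Fin (n G) → Set where
  here : ∀ {u} → P u → Reach G P u u
  step : ∀ {u w v} → P u → adj G u w ≡ true → Reach G P w v → Reach G P u v

AtMost : ∀ {m} → ℕ → (Fin m → Set) → Set
AtMost k S = ¬ (Σ (Fin (suc k) → _) λ f → Injective _≡_ _≡_ f × (∀ i → S (f i)))

-- A model of K_t as a minor of G: disjoint branch sets (vertex v lies in
-- branch set i iff branch v ≡ just i), each nonempty and inducing a
-- connected subgraph, and any two distinct branch sets joined by an edge.
record KMinorModel (t : ℕ) (G : Graph) : Set where
  field
    branch    : Fin (n G) → Maybe (Fin t)
    nonempty  : ∀ i → ∃ λ v → branch v ≡ just i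
    connected : ∀ i u v → branch u ≡ just i → branch v ≡ just i →
                Reach G (λ x → branch x ≡ just i) u v
    adjacent  : ∀ i j → i ≢ j →
                ∃ λ u → ∃ λ v → branch u ≡ just i × branch v ≡ just j × adj G u v ≡ true

HasKMinor : ℕ → Graph → Set
HasKMinor t G = KMinorModel t G

-- Colouring with colour set C (not necessarily proper).
Colouring : Graph → Set → Set
Colouring G C = Fin (n G) → C

MonoComponent : ∀ {C} (G : Graph) → Colouring G C → Fin (n G) → Fin (n G) → Set
MonoComponent G c v u = Reach G (λ x → c x ≡ c v) v u

-- The vertices are partitioned into connected bags 0, 1, 2, … built one after another, keeping
-- the invariant that the earlier bags adjacent to one component of the unbagged vertices pairwise
-- touch. Hence each bag together with the earlier bags it touches contracts to a clique minor.
-- A bag starts at a single vertex and grows along shortest paths through unbagged vertices, each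
-- path reaching an earlier bag not yet touched. Along these paths the roles B and C alternate,
-- except that once two earlier bags are touched, the first vertex of each new path gets role A and
-- is charged to the bag its path reaches. These bags are distinct and differ from the first two,
-- so without a K_t minor a bag has at most t - 4 vertices of role A; likewise a bag touches at most
-- t - 2 earlier bags, so it can take an index in Fin (t - 1) that none of them uses. A vertex of
-- role A is coloured by the index of its bag, one of role B or C by that index paired with its
-- role: adjacent vertices in different bags differ in index, and in one bag differ in role unless
-- both have role A.

module Submission where

open import Defs hiding (sym)
open import Data.Bool using (Bool; true; false; _∨_; _∧_; if_then_else_)
open import Data.Bool.Properties using (¬-not) renaming (_≟_ to _≟ᵇ_)
open import Data.Empty using (⊥; ⊥-elim)
open import Data.Fin using (Fin; zero; suc; toℕ; fromℕ<; cast; join; splitAt)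
import Data.Fin.Properties as Finₚ
open import Data.Fin.Subset using (_∈_; ∣_∣)
open import Data.Fin.Subset.Properties using (∣p∣≤n; p⊂q⇒∣p∣<∣q∣)
open import Data.Nat using (ℕ; zero; suc; _≤_; _<_; _≤′_; ≤′-refl; ≤′-step; _+_; _*_; _∸_; z≤n; s≤s; _≟_; _<?_)
open import Data.Nat.Properties using (+-identityʳ; +-suc; m≤n⇒m<n∨m≡n; ≤-reflexive; <-irrefl;
  <-trans; <⇒≤; ≤-<-trans; ≤-refl; ≤-trans; n≤1+n; m≤m+n; <-≤-trans; ≤-pred; <-cmp; ≮⇒≥; ≤-antisym;
  1+n≰n; ≤⇒≯; ≤⇒≤′)
open import Data.Product using (Σ; ∃; _×_; _,_; proj₁; proj₂)
open import Data.Sum using (_⊎_; inj₁; inj₂; map; map₁; map₂)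
open import Data.Sum.Properties using (inj₁-injective; inj₂-injective)
open import Data.Maybe using (Maybe; just; nothing; maybe′; is-nothing)
import Data.Maybe.Properties as Maybeₚ
open import Data.Vec using (tabulate)
open import Data.Vec.Functional using () renaming (_∷_ to _∷ᶠ_)
open import Data.Vec.Properties using (lookup∘tabulate; []=⇒lookup; lookup⇒[]=)
open import Function using (_∘_)
open import Function.Definitions using (Injective)
open import Relation.Binary using (tri<; tri≈; tri>; DecidableEquality)
open import Relation.Binary.PropositionalEquality using (_≡_; _≢_; refl; sym; trans; cong; subst; module ≡-Reasoning)
open import Relation.Nullary using (¬_; Dec; yes; no; does; _×-dec_; _⊎-dec_; ¬?)
open import Relation.Nullary.Decidable using (dec-true; map′; decidable-stable)
open import Relation.Unary using (Pred; Decidable)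
open import Level using (0ℓ)

private
  variable
    m : ℕ

≡true⇒≢false : ∀ {a} → a ≡ true → a ≢ false
≡true⇒≢false refl ()

∨-trueˡ : ∀ {a} b → a ≡ true → a ∨ b ≡ true
∨-trueˡ b refl = refl

∨-trueʳ : ∀ a {b} → b ≡ true → a ∨ b ≡ true
∨-trueʳ true _ = refl
∨-trueʳ false b≡true = b≡true

∨-true⁻ : ∀ a {b} → a ∨ b ≡ true → a ≡ true ⊎ b ≡ true
∨-true⁻ true _ = inj₁ refl
∨-true⁻ false b≡true = inj₂ b≡true

∧-true⁺ : ∀ {a b} → a ≡ true → b ≡ true → a ∧ b ≡ true
∧-true⁺ refl refl = refl

∧-true⁻ : ∀ a {b} → a ∧ b ≡ true → a ≡ true × b ≡ true
∧-true⁻ true b≡true = refl , b≡true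
∧-true⁻ false ()

does-true⁻ : ∀ {A : Set} (a? : Dec A) → does a? ≡ true → A
does-true⁻ (yes a) _ = a
does-true⁻ (no _) ()

anyᵇ : (Fin m → Bool) → Bool
anyᵇ f = does (Finₚ.any? (λ i → f i ≟ᵇ true))

anyᵇ⁺ : (f : Fin m → Bool) (i : Fin m) → f i ≡ true → anyᵇ f ≡ true
anyᵇ⁺ f i fi = dec-true (Finₚ.any? (λ i → f i ≟ᵇ true)) (i , fi)

anyᵇ⁻ : (f : Fin m → Bool) → anyᵇ f ≡ true → ∃ λ i → f i ≡ true
anyᵇ⁻ f = does-true⁻ (Finₚ.any? (λ i → f i ≟ᵇ true))

card : (Fin m → Bool) → ℕ
card f = ∣ tabulate f ∣

∈-tabulate⁺ : (f : Fin m → Bool) {x : Fin m} → f x ≡ true → x ∈ tabulate f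
∈-tabulate⁺ f {x} fx = lookup⇒[]= x (tabulate f) (trans (lookup∘tabulate f x) fx)

∈-tabulate⁻ : (f : Fin m → Bool) {x : Fin m} → x ∈ tabulate f → f x ≡ true
∈-tabulate⁻ f {x} x∈f = trans (sym (lookup∘tabulate f x)) ([]=⇒lookup x∈f)

card≤ : (f : Fin m → Bool) → card f ≤ m
card≤ f = ∣p∣≤n (tabulate f)

card-< : (f g : Fin m → Bool) → (∀ x → f x ≡ true → g x ≡ true) →
         ∀ x → f x ≡ false → g x ≡ true → card f < card g
card-< f g f⊆g x fx gx = p⊂q⇒∣p∣<∣q∣
  ( (λ {y} y∈f → ∈-tabulate⁺ g (f⊆g y (∈-tabulate⁻ f y∈f)))
  , x , ∈-tabulate⁺ g gx , λ x∈f → ≡true⇒≢false (∈-tabulate⁻ f x∈f) fx )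

adj-sym : (G : Graph) {u v : Fin (n G)} → adj G u v ≡ true → adj G v u ≡ true
adj-sym G {u} {v} = trans (Graph.sym G v u)

module _ {G : Graph} {P : Pred (Fin (n G)) 0ℓ} where

  reach-head : ∀ {u v} → Reach G P u v → P u
  reach-head (here Pu) = Pu
  reach-head (step Pu _ _) = Pu

  reach-last : ∀ {u v} → Reach G P u v → P v
  reach-last (here Pv) = Pv
  reach-last (step _ _ r) = reach-last r

  reach-++ : ∀ {u w v} → Reach G P u w → Reach G P w v → Reach G P u v
  reach-++ (here _) r′ = r′
  reach-++ (step Pu uw r) r′ = step Pu uw (reach-++ r r′)

  reach-reverse : ∀ {u v} → Reach G P u v → Reach G P v u
  reach-reverse (here Pu) = here Pu
  reach-reverse (step Pu uw r) = reach-++ (reach-reverse r) (step (reach-head r) (adj-sym G uw) (here Pu))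

  reach-map : {Q : Pred (Fin (n G)) 0ℓ} → (∀ {x} → P x → Q x) → ∀ {u v} → Reach G P u v → Reach G Q u v
  reach-map f (here Pu) = here (f Pu)
  reach-map f (step Pu uw r) = step (f Pu) uw (reach-map f r)

module BreadthFirstSearch (G : Graph) {P S : Pred (Fin (n G)) 0ℓ}
         (P? : Decidable P) (S? : Decidable S) (S⊆P : ∀ {x} → S x → P x) where

  private
    V : Set
    V = Fin (n G)
    variable
      k l : ℕ
      u w x : V

  layer : ℕ → V → Bool
  layer zero w = does (S? w)
  layer (suc k) w = layer k w ∨ (does (P? w) ∧ anyᵇ (λ u → layer k u ∧ adj G u w))

  layer-suc : ∀ k w → layer k w ≡ true → layer (suc k) w ≡ true
  layer-suc k w = ∨-trueˡ _

  layer-mono : ∀ w → k ≤ l → layer k w ≡ true → layer l w ≡ true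
  layer-mono {k} w k≤l = go (≤⇒≤′ k≤l)
    where
    go : ∀ {l} → _≤′_ k l → layer k w ≡ true → layer l w ≡ true
    go ≤′-refl wk = wk
    go (≤′-step {l} k≤′l) wk = layer-suc l w (go k≤′l wk)

  layer-step : ∀ k → layer k u ≡ true → P w → adj G u w ≡ true → layer (suc k) w ≡ true
  layer-step {u} {w} k uk Pw uw = ∨-trueʳ (layer k w)
    (∧-true⁺ (dec-true (P? w) Pw) (anyᵇ⁺ (λ u → layer k u ∧ adj G u w) u (∧-true⁺ uk uw)))

  layer⇒P : ∀ k w → layer k w ≡ true → P w
  layer⇒P zero w wk = S⊆P (does-true⁻ (S? w) wk)
  layer⇒P (suc k) w wk with ∨-true⁻ (layer k w) wk
  ... | inj₁ wk′ = layer⇒P k w wk′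
  ... | inj₂ new = does-true⁻ (P? w) (proj₁ (∧-true⁻ _ new))

  layer-suc⁻ : ∀ k w → layer (suc k) w ≡ true → layer k w ≡ false →
               ∃ λ u → layer k u ≡ true × adj G u w ≡ true
  layer-suc⁻ k w wk wk′ with ∨-true⁻ (layer k w) wk
  ... | inj₁ old = ⊥-elim (≡true⇒≢false old wk′)
  ... | inj₂ new with anyᵇ⁻ _ (proj₂ (∧-true⁻ _ new))
  ... | u , uw = u , ∧-true⁻ _ uw

  Saturated : ℕ → Set
  Saturated k = ∀ w → layer (suc k) w ≡ true → layer k w ≡ true

  saturated-suc : ∀ k → Saturated k → Saturated (suc k)
  saturated-suc k sat w wk with ∨-true⁻ (layer (suc k) w) wk
  ... | inj₁ old = old
  ... | inj₂ new with ∧-true⁻ _ new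
  ... | Pw , any with anyᵇ⁻ _ any
  ... | u , uw with ∧-true⁻ _ uw
  ... | uk , u-w = layer-step k (sat u uk) (does-true⁻ (P? w) Pw) u-w

  saturated-+ : ∀ j k → Saturated k → Saturated (j + k)
  saturated-+ zero k sat = sat
  saturated-+ (suc j) k sat = saturated-suc (j + k) (saturated-+ j k sat)

  saturated-stays : ∀ k → Saturated k → ∀ j w → layer (j + k) w ≡ true → layer k w ≡ true
  saturated-stays k sat zero w wk = wk
  saturated-stays k sat (suc j) w wk = saturated-stays k sat j w (saturated-+ j k sat w wk)

  saturation : ∀ k → (∃ λ j → j ≤ k × Saturated j) ⊎ k ≤ card (layer k)
  saturation zero = inj₂ z≤n
  saturation (suc k) with saturation k
  ... | inj₁ (j , j≤k , sat) = inj₁ (j , ≤-trans j≤k (n≤1+n k) , sat)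
  ... | inj₂ k≤card with Finₚ.any? (λ w → (layer (suc k) w ≟ᵇ true) ×-dec (layer k w ≟ᵇ false))
  ...   | yes (w , new , old) =
          inj₂ (<-≤-trans (s≤s k≤card) (card-< (layer k) (layer (suc k)) (layer-suc k) w old new))
  ...   | no ¬new = inj₁ (k , n≤1+n k , λ w wk → ¬-not (λ old → ¬new (w , wk , old)))

  -- Every layer that differs from the next adds a vertex, so the layers are constant from step n G
  -- on and ball contains every vertex reachable from S.
  ball : V → Bool
  ball = layer (suc (n G))

  layer⊆ball : ∀ k w → layer k w ≡ true → ball w ≡ true
  layer⊆ball k w wk with saturation (suc (n G))
  ... | inj₂ tooBig = ⊥-elim (≤⇒≯ (card≤ (layer (suc (n G)))) tooBig)
  ... | inj₁ (j , j≤ , sat) = layer-mono w j≤ (saturated-stays j sat k w (layer-mono w (m≤m+n k j) wk))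

  reach⇒layer : ∀ k → layer k u ≡ true → Reach G P u w → ∃ λ l → layer l w ≡ true
  reach⇒layer k uk (here _) = k , uk
  reach⇒layer k uk (step _ uw r) = reach⇒layer (suc k) (layer-step k uk (reach-head r) uw) r

  reach⇒ball : S u → Reach G P u w → ball w ≡ true
  reach⇒ball {u} {w} Su r with reach⇒layer 0 (dec-true (S? u) Su) r
  ... | l , wl = layer⊆ball l w wl

  record Dist (k : ℕ) (w : V) : Set where
    field
      reached    : layer k w ≡ true
      not-sooner : ∀ j → j < k → layer j w ≡ false

  open Dist

  dist-exists : ∀ l w → layer l w ≡ true → ∃ λ k → Dist k w
  dist-exists zero w w0 = zero , record { reached = w0 ; not-sooner = λ _ () }
  dist-exists (suc l) w wl with layer l w ≟ᵇ true
  ... | yes wl′ = dist-exists l w wl′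
  ... | no ¬wl′ = suc l , record { reached = wl ; not-sooner = λ j j<sl → sooner j (≤-pred j<sl) }
    where
    sooner : ∀ j → j ≤ l → layer j w ≡ false
    sooner j j≤l = ¬-not (λ wj → ¬wl′ (layer-mono w j≤l wj))

  dist⇒P : Dist k x → P x
  dist⇒P {k} {x} dx = layer⇒P k x (reached dx)

  dist-zero : S x → Dist 0 x
  dist-zero {x} Sx = record { reached = dec-true (S? x) Sx ; not-sooner = λ _ () }

  dist-zero⁻ : Dist 0 x → S x
  dist-zero⁻ {x} dx = does-true⁻ (S? x) (reached dx)

  dist-suc⇒∉S : Dist (suc k) x → ¬ S x
  dist-suc⇒∉S {x = x} dx Sx = ≡true⇒≢false (dec-true (S? x) Sx) (not-sooner dx 0 (s≤s z≤n))

  dist-adj : Dist k u → Dist l w → adj G u w ≡ true → l ≤ suc k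
  dist-adj {k} {u} {l} {w} du dw uw with suc k <? l
  ... | yes sk<l = ⊥-elim (≡true⇒≢false (layer-step k (reached du) (dist⇒P dw) uw) (not-sooner dw (suc k) sk<l))
  ... | no ¬sk<l = ≮⇒≥ ¬sk<l

  private
    parent? : ∀ k w → Dec (∃ λ u → (layer k u ∧ adj G u w) ≡ true)
    parent? k w = Finₚ.any? (λ u → (layer k u ∧ adj G u w) ≟ᵇ true)

  parent : ℕ → V → V
  parent k w with parent? k w
  ... | yes (u , _) = u
  ... | no _ = w

  private
    parent-spec : ∀ k w → Dist (suc k) w → Dist k (parent k w) × adj G (parent k w) w ≡ true
    parent-spec k w dw with parent? k w
    ... | yes (u , uw) with ∧-true⁻ _ uw
    ... | uk , u-w = record { reached = uk ; not-sooner = sooner } , u-w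
      where
      sooner : ∀ j → j < k → layer j u ≡ false
      sooner j j<k = ¬-not (λ uj → ≡true⇒≢false (layer-step j uj (dist⇒P dw) u-w) (not-sooner dw (suc j) (s≤s j<k)))
    parent-spec k w dw | no ¬parent with layer-suc⁻ k w (reached dw) (not-sooner dw k ≤-refl)
    ... | u , uk , uw = ⊥-elim (¬parent (u , ∧-true⁺ uk uw))

  parent-dist : ∀ k w → Dist (suc k) w → Dist k (parent k w)
  parent-dist k w dw = proj₁ (parent-spec k w dw)

  parent-adj : ∀ k w → Dist (suc k) w → adj G (parent k w) w ≡ true
  parent-adj k w dw = proj₂ (parent-spec k w dw)

  -- geodesic k w x ≡ just j: x is the vertex at distance j on a fixed shortest path from S to w.
  geodesic : ℕ → V → V → Maybe ℕ
  geodesic zero w x = nothing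
  geodesic (suc k) w x with x Finₚ.≟ w
  ... | yes _ = just (suc k)
  ... | no _ = geodesic k (parent k w) x

  OnGeodesic : ℕ → V → V → Set
  OnGeodesic k w x = ∃ λ j → geodesic k w x ≡ just j

  geodesic-end : ∀ k w → geodesic (suc k) w w ≡ just (suc k)
  geodesic-end k w with w Finₚ.≟ w
  ... | yes _ = refl
  ... | no w≢w = ⊥-elim (w≢w refl)

  geodesic-dist : ∀ k w → Dist k w → ∀ {x j} → geodesic k w x ≡ just j → Dist j x × 1 ≤ j × j ≤ k
  geodesic-dist zero w dw ()
  geodesic-dist (suc k) w dw {x} gx with x Finₚ.≟ w
  geodesic-dist (suc k) w dw refl | yes refl = dw , s≤s z≤n , ≤-refl
  ... | no _ with geodesic-dist k (parent k w) (parent-dist k w dw) gx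
  ... | dx , 1≤j , j≤k = dx , 1≤j , ≤-trans j≤k (n≤1+n k)

  geodesic-injective : ∀ k w → Dist k w → ∀ {x y j} → geodesic k w x ≡ just j → geodesic k w y ≡ just j → x ≡ y
  geodesic-injective zero w dw ()
  geodesic-injective (suc k) w dw {x} {y} gx gy with x Finₚ.≟ w | y Finₚ.≟ w
  ... | yes x≡w | yes y≡w = trans x≡w (sym y≡w)
  ... | yes _   | no _    = ⊥-elim (1+n≰n (proj₂ (proj₂ (geodesic-dist k _ (parent-dist k w dw) (trans gy (sym gx))))))
  ... | no _    | yes _   = ⊥-elim (1+n≰n (proj₂ (proj₂ (geodesic-dist k _ (parent-dist k w dw) (trans gx (sym gy))))))
  ... | no _    | no _    = geodesic-injective k (parent k w) (parent-dist k w dw) gx gy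

  geodesic-parent : ∀ k w x → OnGeodesic k (parent k w) x → OnGeodesic (suc k) w x
  geodesic-parent k w x (j , gx) with x Finₚ.≟ w
  ... | yes _ = suc k , refl
  ... | no _ = j , gx

  geodesic-start : ∀ k w → Dist k w → OnGeodesic k w w ⊎ S w
  geodesic-start zero w dw = inj₂ (dist-zero⁻ dw)
  geodesic-start (suc k) w dw = inj₁ (suc k , geodesic-end k w)

  ToSource : ℕ → V → V → Set
  ToSource k w x = ∃ λ s → S s × Reach G (λ z → OnGeodesic k w z ⊎ S z) x s

  to-source-parent : ∀ k w x → ToSource k (parent k w) x → ToSource (suc k) w x
  to-source-parent k w x (s , Ss , r) = s , Ss , reach-map (map₁ (geodesic-parent k w _)) r

  geodesic-to-source : ∀ k w → Dist k w → ∀ x → OnGeodesic k w x → ToSource k w x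
  geodesic-to-source zero w dw x (_ , ())
  geodesic-to-source (suc k) w dw x onx with x Finₚ.≟ w
  ... | no _ = to-source-parent k w x (geodesic-to-source k (parent k w) (parent-dist k w dw) x onx)
  ... | yes x≡w = subst (ToSource (suc k) w) (sym x≡w) (prepend (from-parent (geodesic-start k p dp)))
    where
    p : V
    p = parent k w

    dp : Dist k p
    dp = parent-dist k w dw

    from-parent : OnGeodesic k p p ⊎ S p → ToSource (suc k) w p
    from-parent (inj₁ onp) = to-source-parent k w p (geodesic-to-source k p dp p onp)
    from-parent (inj₂ Sp) = p , Sp , here (inj₂ Sp)

    prepend : ToSource (suc k) w p → ToSource (suc k) w w
    prepend (s , Ss , r) = s , Ss , step (inj₁ (suc k , geodesic-end k w)) (adj-sym G (parent-adj k w dw)) r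

record Touching (G : Graph) (bag : Fin (n G) → Maybe ℕ) (c c′ : ℕ) : Set where
  constructor touching
  field
    z z′ : Fin (n G)
    bz   : bag z ≡ just c
    bz′  : bag z′ ≡ just c′
    zz′  : adj G z z′ ≡ true

BagConnected : (G : Graph) → (Fin (n G) → Maybe ℕ) → ℕ → Set
BagConnected G bag c = ∀ x x′ → bag x ≡ just c → bag x′ ≡ just c → Reach G (λ z → bag z ≡ just c) x x′

EarlierClique : (G : Graph) → (Fin (n G) → Maybe ℕ) → ℕ → Set
EarlierClique G bag b = ∀ {c c′} → c < b → c′ < b → Touching G bag b c → Touching G bag b c′ →
                        c ≡ c′ ⊎ Touching G bag c c′

module _ {G : Graph} where

  touching-sym : ∀ {bag c c′} → Touching G bag c c′ → Touching G bag c′ c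
  touching-sym (touching z z′ bz bz′ zz′) = touching z′ z bz′ bz (adj-sym G zz′)

  touching-map : ∀ {bag bag′ : Fin (n G) → Maybe ℕ} {c c′} →
                 (∀ {x} → bag x ≡ just c → bag′ x ≡ just c) →
                 (∀ {x} → bag x ≡ just c′ → bag′ x ≡ just c′) →
                 Touching G bag c c′ → Touching G bag′ c c′
  touching-map f f′ (touching z z′ bz bz′ zz′) = touching z z′ (f bz) (f′ bz′) zz′

touching-bags⇒minor : ∀ {t} (G : Graph) (bag : Fin (n G) → Maybe ℕ) (h : Fin (suc (suc t)) → ℕ) →
                      Injective _≡_ _≡_ h → (∀ i → BagConnected G bag (h i)) →
                      (∀ i j → i ≢ j → Touching G bag (h i) (h j)) → KMinorModel (suc (suc t)) G
touching-bags⇒minor {t} G bag h h-inj connected touches = record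
  { branch    = branch
  ; nonempty  = λ i → let open Touching (touches i (other i) (≢-other i)) in z , branch-just bz
  ; connected = λ i u v bu bv →
      reach-map branch-just (connected i u v (just-branch (bag u) bu) (just-branch (bag v) bv))
  ; adjacent  = λ i j i≢j → let open Touching (touches i j i≢j) in
                  z , z′ , branch-just bz , branch-just bz′ , zz′
  }
  where
  find : Maybe ℕ → Maybe (Fin (suc (suc t)))
  find nothing = nothing
  find (just c) with Finₚ.any? (λ i → h i ≟ c)
  ... | yes (i , _) = just i
  ... | no _ = nothing

  branch : Fin (n G) → Maybe (Fin (suc (suc t)))
  branch x = find (bag x)

  just-branch : ∀ {i} m → find m ≡ just i → m ≡ just (h i)
  just-branch (just c) eq with Finₚ.any? (λ i → h i ≟ c)
  just-branch (just c) refl | yes (i , hi≡c) = cong just (sym hi≡c)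

  branch-just : ∀ {i x} → bag x ≡ just (h i) → branch x ≡ just i
  branch-just {i} {x} bx rewrite bx with Finₚ.any? (λ j → h j ≟ h i)
  ... | yes (j , hj≡hi) = cong just (h-inj hj≡hi)
  ... | no none = ⊥-elim (none (i , refl))

  other : Fin (suc (suc t)) → Fin (suc (suc t))
  other zero = suc zero
  other (suc _) = zero

  ≢-other : ∀ i → i ≢ other i
  ≢-other zero ()
  ≢-other (suc i) ()

∷-injective : ∀ {n} {X : Set} (a : X) (f : Fin n → X) → Injective _≡_ _≡_ f → (∀ i → f i ≢ a) →
              Injective _≡_ _≡_ (a ∷ᶠ f)
∷-injective a f f-inj f≢a {zero} {zero} _ = refl
∷-injective a f f-inj f≢a {zero} {suc j} eq = ⊥-elim (f≢a j (sym eq))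
∷-injective a f f-inj f≢a {suc i} {zero} eq = ⊥-elim (f≢a i eq)
∷-injective a f f-inj f≢a {suc i} {suc j} eq = cong suc (f-inj eq)

cone⇒minor : ∀ {t} (G : Graph) (bag : Fin (n G) → Maybe ℕ) (b : ℕ) (g : Fin (suc t) → ℕ) →
             Injective _≡_ _≡_ g → (∀ i → g i < b) → (∀ i → Touching G bag b (g i)) →
             EarlierClique G bag b →
             BagConnected G bag b → (∀ i → BagConnected G bag (g i)) → KMinorModel (suc (suc t)) G
cone⇒minor G bag b g g-inj g<b touch clique b-connected g-connected =
  touching-bags⇒minor G bag (b ∷ᶠ g) h-inj h-connected h-touching
  where
  h-inj : Injective _≡_ _≡_ (b ∷ᶠ g)
  h-inj = ∷-injective b g g-inj (λ i gi≡b → <-irrefl gi≡b (g<b i))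

  h-connected : ∀ i → BagConnected G bag ((b ∷ᶠ g) i)
  h-connected zero = b-connected
  h-connected (suc i) = g-connected i

  h-touching : ∀ i j → i ≢ j → Touching G bag ((b ∷ᶠ g) i) ((b ∷ᶠ g) j)
  h-touching zero zero i≢j = ⊥-elim (i≢j refl)
  h-touching zero (suc j) _ = touch j
  h-touching (suc i) zero _ = touching-sym (touch i)
  h-touching (suc i) (suc j) i≢j with clique (g<b i) (g<b j) (touch i) (touch j)
  ... | inj₁ eq = ⊥-elim (i≢j (h-inj {suc i} {suc j} eq))
  ... | inj₂ t = t

data Role : Set where
  A B C : Role

alternate : ℕ → Role
alternate zero = B
alternate (suc zero) = C
alternate (suc (suc j)) = alternate j

alternate-≢-suc : ∀ j → alternate j ≢ alternate (suc j)
alternate-≢-suc zero ()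
alternate-≢-suc (suc zero) ()
alternate-≢-suc (suc (suc j)) = alternate-≢-suc j

alternate-≢-A : ∀ j → alternate j ≢ A
alternate-≢-A zero ()
alternate-≢-A (suc zero) ()
alternate-≢-A (suc (suc j)) = alternate-≢-A j

-- Roles along a path added to a bag, by distance from the bag. The root has role B; vertices at
-- distance 1 may be adjacent to vertices of both roles once the bag has been extended.
firstLevelRole : Bool → Role
firstLevelRole true = A
firstLevelRole false = C

pathRole : Bool → ℕ → Role
pathRole e zero = B
pathRole e (suc zero) = firstLevelRole e
pathRole e (suc (suc j)) = alternate j

pathRole-adjacent : ∀ e j → 1 ≤ j → pathRole e j ≡ pathRole e (suc j) → pathRole e j ≡ A
pathRole-adjacent true (suc zero) _ _ = refl
pathRole-adjacent false (suc zero) _ ()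
pathRole-adjacent e (suc (suc j)) _ eq = ⊥-elim (alternate-≢-suc j eq)

pathRole≡A : ∀ e j → pathRole e j ≡ A → e ≡ true × j ≡ 1
pathRole≡A true (suc zero) _ = refl , refl
pathRole≡A false (suc zero) ()
pathRole≡A e (suc (suc j)) eq = ⊥-elim (alternate-≢-A j eq)

module Bags (G : Graph) (M : ℕ) where

  V : Set
  V = Fin (n G)

  -- target x is the earlier bag an A-vertex x is charged to; first b and second b are the first
  -- two earlier bags that bag b touched.
  record Labelling : Set where
    field
      bag    : V → Maybe ℕ
      role   : V → Role
      target : V → ℕ
      index  : ℕ → Fin M
      first  : ℕ → ℕ
      second : ℕ → ℕ

  record TwoEarlierTouching (bag : V → Maybe ℕ) (b f s : ℕ) : Set where
    field
      f<b     : f < b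
      s<b     : s < b
      touch-f : Touching G bag b f
      touch-s : Touching G bag b s
      f≢s     : f ≢ s

  record ThreeEarlierTouching (bag : V → Maybe ℕ) (b τ f s : ℕ) : Set where
    field
      two     : TwoEarlierTouching bag b f s
      τ<b     : τ < b
      touch-τ : Touching G bag b τ
      τ≢f     : τ ≢ f
      τ≢s     : τ ≢ s

  two-map : ∀ {bag bag′ b f s} → (∀ {x c} → c ≤ b → bag x ≡ just c → bag′ x ≡ just c) →
            TwoEarlierTouching bag b f s → TwoEarlierTouching bag′ b f s
  two-map fw t = record
    { f<b = f<b ; s<b = s<b ; f≢s = f≢s
    ; touch-f = touching-map (fw ≤-refl) (fw (<⇒≤ f<b)) touch-f
    ; touch-s = touching-map (fw ≤-refl) (fw (<⇒≤ s<b)) touch-s }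
    where open TwoEarlierTouching t

  three-map : ∀ {bag bag′ b τ f s} → (∀ {x c} → c ≤ b → bag x ≡ just c → bag′ x ≡ just c) →
              ThreeEarlierTouching bag b τ f s → ThreeEarlierTouching bag′ b τ f s
  three-map fw t = record
    { two = two-map fw two ; τ<b = τ<b ; τ≢f = τ≢f ; τ≢s = τ≢s
    ; touch-τ = touching-map (fw ≤-refl) (fw (<⇒≤ τ<b)) touch-τ }
    where open ThreeEarlierTouching t

  record Complete (L : Labelling) (b : ℕ) : Set where
    open Labelling L
    field
      connected      : BagConnected G bag b
      proper         : ∀ {x x′} → bag x ≡ just b → bag x′ ≡ just b → adj G x x′ ≡ true →
                       role x ≡ role x′ → role x ≡ A
      fresh-index    : ∀ {x y c} → bag x ≡ just b → bag y ≡ just c → c < b → adj G x y ≡ true →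
                       index c ≢ index b
      earlier-clique : EarlierClique G bag b
      A-targets      : ∀ {x} → bag x ≡ just b → role x ≡ A → ThreeEarlierTouching bag b (target x) (first b) (second b)
      A-injective    : ∀ {x x′} → bag x ≡ just b → bag x′ ≡ just b → role x ≡ A → role x′ ≡ A →
                       target x ≡ target x′ → x ≡ x′

  record Agree (b₀ : ℕ) (L L′ : Labelling) : Set where
    private
      module L = Labelling L
      module L′ = Labelling L′
    field
      bag-below    : ∀ {x c} → c < b₀ → L.bag x ≡ just c → L′.bag x ≡ just c
      bag-below⁻   : ∀ {x c} → c < b₀ → L′.bag x ≡ just c → L.bag x ≡ just c
      role-below   : ∀ {x c} → c < b₀ → L.bag x ≡ just c → L′.role x ≡ L.role x
      target-below : ∀ {x c} → c < b₀ → L.bag x ≡ just c → L′.target x ≡ L.target x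
      index-below  : ∀ {c} → c < b₀ → L′.index c ≡ L.index c
      first-below  : ∀ {c} → c < b₀ → L′.first c ≡ L.first c
      second-below : ∀ {c} → c < b₀ → L′.second c ≡ L.second c

  complete-transport : ∀ {b₀ L L′ b} → b < b₀ → Agree b₀ L L′ → Complete L b → Complete L′ b
  complete-transport {b₀} {L} {L′} {b} b<b₀ ag cb = record
    { connected      = λ x x′ bx bx′ → reach-map (bag-below b<b₀) (connected x x′ (back bx) (back bx′))
    ; proper         = λ bx bx′ xx′ same → trans (role-eq bx)
                         (proper (back bx) (back bx′) xx′ (trans (sym (role-eq bx)) (trans same (role-eq bx′))))
    ; fresh-index    = λ {x} {y} {c} bx by c<b xy same → fresh-index (back bx) (bag-below⁻ (<-trans c<b b<b₀) by) c<b xy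
                         (trans (sym (index-below (<-trans c<b b<b₀))) (trans same (index-below b<b₀)))
    ; earlier-clique = clique
    ; A-targets      = targets
    ; A-injective    = λ bx bx′ rx rx′ same → A-injective (back bx) (back bx′)
                         (trans (sym (role-eq bx)) rx) (trans (sym (role-eq bx′)) rx′)
                         (trans (sym (target-eq bx)) (trans same (target-eq bx′)))
    }
    where
    open Agree ag
    open Complete cb
    module L = Labelling L
    module L′ = Labelling L′

    back : ∀ {x} → L′.bag x ≡ just b → L.bag x ≡ just b
    back = bag-below⁻ b<b₀

    role-eq : ∀ {x} → L′.bag x ≡ just b → L′.role x ≡ L.role x
    role-eq bx = role-below b<b₀ (back bx)

    target-eq : ∀ {x} → L′.bag x ≡ just b → L′.target x ≡ L.target x
    target-eq bx = target-below b<b₀ (back bx)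

    forth-touch : ∀ {c c′} → c < b₀ → c′ < b₀ → Touching G L.bag c c′ → Touching G L′.bag c c′
    forth-touch c<b₀ c′<b₀ = touching-map (bag-below c<b₀) (bag-below c′<b₀)

    back-touch : ∀ {c c′} → c < b₀ → c′ < b₀ → Touching G L′.bag c c′ → Touching G L.bag c c′
    back-touch c<b₀ c′<b₀ = touching-map (bag-below⁻ c<b₀) (bag-below⁻ c′<b₀)

    clique : ∀ {c c′} → c < b → c′ < b → Touching G L′.bag b c → Touching G L′.bag b c′ →
             c ≡ c′ ⊎ Touching G L′.bag c c′
    clique c<b c′<b tc tc′ with earlier-clique c<b c′<b (back-touch b<b₀ (<-trans c<b b<b₀) tc)
                                                        (back-touch b<b₀ (<-trans c′<b b<b₀) tc′)
    ... | inj₁ c≡c′ = inj₁ c≡c′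
    ... | inj₂ t = inj₂ (forth-touch (<-trans c<b b<b₀) (<-trans c′<b b<b₀) t)

    targets : ∀ {x} → L′.bag x ≡ just b → L′.role x ≡ A →
              ThreeEarlierTouching L′.bag b (L′.target x) (L′.first b) (L′.second b)
    targets {x} bx rx rewrite target-eq bx | first-below b<b₀ | second-below b<b₀ =
      three-map (λ c≤b → bag-below (≤-<-trans c≤b b<b₀)) (A-targets (back bx) (trans (sym (role-eq bx)) rx))

iterate : {S F : Set} (μ : S → ℕ) → ((s : S) → (Σ S λ s′ → μ s′ < μ s) ⊎ F) → S → F
iterate {S} {F} μ next s = go (suc (μ s)) s ≤-refl
  where
  go : ∀ fuel s → μ s < fuel → F
  go (suc fuel) s μs<fuel with next s
  ... | inj₂ f = f
  ... | inj₁ (s′ , μs′<μs) = go fuel s′ (<-≤-trans μs′<μs (≤-pred μs<fuel))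

override : {A X : Set} → DecidableEquality A → (A → X) → A → X → A → X
override _≟_ f a x b with b ≟ a
... | yes _ = x
... | no _ = f b

override-≡ : {A X : Set} (_≟_ : DecidableEquality A) (f : A → X) (a : A) (x : X) → override _≟_ f a x a ≡ x
override-≡ _≟_ f a x with a ≟ a
... | yes _ = refl
... | no a≢a = ⊥-elim (a≢a refl)

override-≢ : {A X : Set} (_≟_ : DecidableEquality A) (f : A → X) (a : A) (x : X) {b : A} → b ≢ a →
             override _≟_ f a x b ≡ f b
override-≢ _≟_ f a x {b} b≢a with b ≟ a
... | yes b≡a = ⊥-elim (b≢a b≡a)
... | no _ = refl

_≟ₘ_ : DecidableEquality (Maybe ℕ)
_≟ₘ_ = Maybeₚ.≡-dec _≟_

module Construction (G : Graph) (m : ℕ) (noMinor : ¬ KMinorModel (suc (suc m)) G) where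

  open Bags G (suc m)

  Avail : (V → Maybe ℕ) → ℕ → V → Set
  Avail bag o z = bag z ≡ nothing ⊎ bag z ≡ just o

  avail? : ∀ bag o → Decidable (Avail bag o)
  avail? bag o z = (bag z ≟ₘ nothing) ⊎-dec (bag z ≟ₘ just o)

  NoEarlierNeighbour : (V → Maybe ℕ) → ℕ → Set
  NoEarlierNeighbour bag o = ∀ {u y c} → Avail bag o u → bag y ≡ just c → c < o → adj G u y ≡ true → ⊥

  unbagged : (V → Maybe ℕ) → ℕ
  unbagged bag = card (λ x → is-nothing (bag x))

  record Growing : Set where
    field
      labelling : Labelling
    open Labelling labelling public
    field
      current         : ℕ
      root            : V
      extended        : Bool
      firstNeighbour  : ℕ
      secondNeighbour : ℕ
      bag≤current  : ∀ {x c} → bag x ≡ just c → c ≤ current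
      complete     : ∀ {c} → c < current → Complete labelling c
      avail-clique : ∀ {u u′ y y′ c c′} → Reach G (Avail bag current) u u′ →
                     adj G u y ≡ true → adj G u′ y′ ≡ true → bag y ≡ just c → bag y′ ≡ just c′ →
                     c < current → c′ < current → c ≡ c′ ⊎ Touching G bag c c′
      root-bag     : bag root ≡ just current
      root-B       : role root ≡ B
      to-root      : ∀ {x} → bag x ≡ just current → Reach G (λ z → bag z ≡ just current) x root
      proper       : ∀ {x x′} → bag x ≡ just current → bag x′ ≡ just current → adj G x x′ ≡ true →
                     role x ≡ role x′ → role x ≡ A
      singleton    : extended ≡ false → ∀ {x} → bag x ≡ just current → x ≡ root
      two-touching : extended ≡ true → TwoEarlierTouching bag current firstNeighbour secondNeighbour
      A-vertices   : ∀ {x} → bag x ≡ just current → role x ≡ A →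
                     extended ≡ true × ThreeEarlierTouching bag current (target x) firstNeighbour secondNeighbour
      A-injective  : ∀ {x x′} → bag x ≡ just current → bag x′ ≡ just current → role x ≡ A → role x′ ≡ A →
                     target x ≡ target x′ → x ≡ x′
      anchored     : NoEarlierNeighbour bag current ⊎
                     (firstNeighbour < current × ∃ λ y → bag y ≡ just firstNeighbour × adj G root y ≡ true)

  module Search (s : Growing) =
    BreadthFirstSearch G (avail? (Growing.bag s) (Growing.current s))
                         (λ z → Growing.bag s z ≟ₘ just (Growing.current s)) inj₂

  record Candidate (s : Growing) : Set where
    open Growing s
    open Search s using (ball)
    field
      w y        : V
      c          : ℕ
      w-ball     : ball w ≡ true
      w-unbagged : bag w ≡ nothing
      wy         : adj G w y ≡ true
      y-bag      : bag y ≡ just c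
      c<current  : c < current
      untouched  : ¬ Touching G bag current c

  module Extend (s : Growing) (cand : Candidate s) where
    open Growing s
    open Candidate cand
    open Search s

    private
      d : ℕ
      d = proj₁ (dist-exists (suc (n G)) w w-ball)

      w-dist : Dist d w
      w-dist = proj₂ (dist-exists (suc (n G)) w w-ball)

    onPath : V → Maybe ℕ
    onPath = geodesic d w

    on-dist : ∀ {x j} → onPath x ≡ just j → Dist j x × 1 ≤ j × j ≤ d
    on-dist = geodesic-dist d w w-dist

    w-on : onPath w ≡ just d
    w-on = end d w-dist
      where
      end : ∀ k → Dist k w → geodesic k w w ≡ just k
      end zero dw with trans (sym w-unbagged) (dist-zero⁻ dw)
      ... | ()
      end (suc k) _ = geodesic-end k w

    on⇒unbagged : ∀ {x j} → onPath x ≡ just j → bag x ≡ nothing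
    on⇒unbagged p with on-dist p
    ... | dx , s≤s z≤n , _ with dist⇒P dx
    ...   | inj₁ unbagged-x = unbagged-x
    ...   | inj₂ in-current = ⊥-elim (dist-suc⇒∉S dx in-current)

    on? : ∀ x → (∃ λ j → onPath x ≡ just j) ⊎ onPath x ≡ nothing
    on? x with onPath x
    ... | just j = inj₁ (j , refl)
    ... | nothing = inj₂ refl

    relabel : {X : Set} → (ℕ → X) → (V → X) → V → X
    relabel f old x = maybe′ f (old x) (onPath x)

    relabel-on : ∀ {X : Set} (f : ℕ → X) (old : V → X) {x j} → onPath x ≡ just j → relabel f old x ≡ f j
    relabel-on f old {x} = cong (maybe′ f (old x))

    relabel-off : ∀ {X : Set} (f : ℕ → X) (old : V → X) {x} → onPath x ≡ nothing → relabel f old x ≡ old x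
    relabel-off f old {x} = cong (maybe′ f (old x))

    bag′ : V → Maybe ℕ
    bag′ = relabel (λ _ → just current) bag

    role′ : V → Role
    role′ = relabel (pathRole extended) role

    target′ : V → ℕ
    target′ = relabel (λ _ → c) target

    secondNeighbour′ : ℕ
    secondNeighbour′ = if extended then secondNeighbour else c

    L′ : Labelling
    L′ = record labelling { bag = bag′ ; role = role′ ; target = target′ }

    bagged⇒off : ∀ {x c′} → bag x ≡ just c′ → onPath x ≡ nothing
    bagged⇒off {x} bx with on? x
    ... | inj₂ off = off
    ... | inj₁ (_ , p) with trans (sym bx) (on⇒unbagged p)
    ...   | ()

    bag-old : ∀ {x c′} → bag x ≡ just c′ → bag′ x ≡ just c′
    bag-old bx = trans (relabel-off _ bag (bagged⇒off bx)) bx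

    bag′-below : ∀ {x c′} → c′ < current → bag′ x ≡ just c′ → bag x ≡ just c′
    bag′-below {x} c′<o bx with on? x
    ... | inj₁ (_ , p) = ⊥-elim (<-irrefl (Maybeₚ.just-injective (trans (sym bx) (relabel-on _ bag p))) c′<o)
    ... | inj₂ off = trans (sym (relabel-off _ bag off)) bx

    bag′-current : ∀ {x} → bag′ x ≡ just current →
                   (∃ λ j → onPath x ≡ just j) ⊎ (onPath x ≡ nothing × bag x ≡ just current)
    bag′-current {x} bx with on? x
    ... | inj₁ on = inj₁ on
    ... | inj₂ off = inj₂ (off , trans (sym (relabel-off _ bag off)) bx)

    avail′⇒avail : ∀ {x} → Avail bag′ current x → Avail bag current x
    avail′⇒avail {x} ax with on? x
    ... | inj₁ (_ , p) = inj₁ (on⇒unbagged p)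
    ... | inj₂ off rewrite relabel-off (λ _ → just current) bag off = ax

    touch′ : ∀ {a b} → Touching G bag a b → Touching G bag′ a b
    touch′ = touching-map bag-old bag-old

    w-touches-c : Touching G bag′ current c
    w-touches-c = touching w y (relabel-on _ bag w-on) (bag-old y-bag) wy

    agree : Agree current labelling L′
    agree = record
      { bag-below    = λ _ → bag-old
      ; bag-below⁻   = bag′-below
      ; role-below   = λ _ bx → relabel-off _ role (bagged⇒off bx)
      ; target-below = λ _ bx → relabel-off _ target (bagged⇒off bx)
      ; index-below  = λ _ → refl
      ; first-below  = λ _ → refl
      ; second-below = λ _ → refl
      }

    level-adjacent : ∀ {x x′ j j′} → onPath x ≡ just j → onPath x′ ≡ just j′ → adj G x x′ ≡ true →
                     j′ ≡ suc j ⊎ j ≡ suc j′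
    level-adjacent {x} {j = j} {j′} p p′ xx′ with on-dist p | on-dist p′ | <-cmp j j′
    ... | dx , _ | dx′ , _ | tri< j<j′ _ _ = inj₁ (≤-antisym (dist-adj dx dx′ xx′) j<j′)
    ... | dx , _ | dx′ , _ | tri> _ _ j′<j = inj₂ (≤-antisym (dist-adj dx′ dx (adj-sym G xx′)) j′<j)
    ... | _ | _ | tri≈ _ refl _ with geodesic-injective d w w-dist p p′
    ...   | refl = ⊥-elim (≡true⇒≢false xx′ (Graph.irrefl G x))

    level-next-to-bag : ∀ {x x′ j} → onPath x ≡ just j → bag x′ ≡ just current → adj G x′ x ≡ true → j ≡ 1
    level-next-to-bag p bx′ x′x with on-dist p
    ... | dx , 1≤j , _ = ≤-antisym (dist-adj (dist-zero bx′) dx x′x) 1≤j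

    role-on : ∀ {x j} → onPath x ≡ just j → role′ x ≡ pathRole extended j
    role-on = relabel-on (pathRole extended) role

    role-off : ∀ {x} → onPath x ≡ nothing → role′ x ≡ role x
    role-off = relabel-off (pathRole extended) role

    first-level-meets-old : ∀ {x} → bag x ≡ just current → firstLevelRole extended ≡ role x →
                            firstLevelRole extended ≡ A
    first-level-meets-old bx same with extended in e
    ... | true = refl
    ... | false with singleton e bx
    ...   | refl with trans same root-B
    ...     | ()

    proper′ : ∀ {x x′} → bag′ x ≡ just current → bag′ x′ ≡ just current → adj G x x′ ≡ true →
              role′ x ≡ role′ x′ → role′ x ≡ A
    proper′ bx bx′ xx′ same with bag′-current bx | bag′-current bx′
    ... | inj₁ (j , p) | inj₁ (j′ , p′)
          rewrite role-on p | role-on p′ with level-adjacent p p′ xx′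
    ...   | inj₁ refl = pathRole-adjacent extended j (proj₁ (proj₂ (on-dist p))) same
    ...   | inj₂ refl = trans same (pathRole-adjacent extended j′ (proj₁ (proj₂ (on-dist p′))) (sym same))
    proper′ bx bx′ xx′ same | inj₁ (j , p) | inj₂ (p′ , b′)
          rewrite role-on p | role-off p′ | level-next-to-bag p b′ (adj-sym G xx′) = first-level-meets-old b′ same
    proper′ bx bx′ xx′ same | inj₂ (p , b) | inj₁ (j′ , p′)
          rewrite role-off p | role-on p′ | level-next-to-bag p′ b xx′ = trans same (first-level-meets-old b (sym same))
    proper′ bx bx′ xx′ same | inj₂ (p , b) | inj₂ (p′ , b′)
          rewrite role-off p | role-off p′ = proper b b′ xx′ same

    A-on-path : ∀ {x j} → onPath x ≡ just j → role′ x ≡ A → extended ≡ true × j ≡ 1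
    A-on-path p r = pathRole≡A extended _ (trans (sym (role-on p)) r)

    secondNeighbour′-extended : extended ≡ true → secondNeighbour′ ≡ secondNeighbour
    secondNeighbour′-extended e rewrite e = refl

    c≢touched : ∀ {f} → Touching G bag current f → c ≢ f
    c≢touched t refl = untouched t

    new-A-three : extended ≡ true → ThreeEarlierTouching bag′ current c firstNeighbour secondNeighbour
    new-A-three e = record
      { two = two-map (λ _ → bag-old) (two-touching e)
      ; τ<b = c<current ; touch-τ = w-touches-c ; τ≢f = c≢touched touch-f ; τ≢s = c≢touched touch-s }
      where open TwoEarlierTouching (two-touching e)

    target-on : ∀ {x j} → onPath x ≡ just j → target′ x ≡ c
    target-on = relabel-on (λ _ → c) target

    target-off : ∀ {x} → onPath x ≡ nothing → target′ x ≡ target x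
    target-off = relabel-off (λ _ → c) target

    A-vertices′ : ∀ {x} → bag′ x ≡ just current → role′ x ≡ A →
                  true ≡ true × ThreeEarlierTouching bag′ current (target′ x) firstNeighbour secondNeighbour′
    A-vertices′ bx r with bag′-current bx
    ... | inj₁ (j , p) with A-on-path p r
    ...   | e , _ rewrite target-on p | secondNeighbour′-extended e = refl , new-A-three e
    A-vertices′ bx r | inj₂ (p , b) with A-vertices b (trans (sym (role-off p)) r)
    ... | e , three rewrite target-off p | secondNeighbour′-extended e = refl , three-map (λ _ → bag-old) three

    two-touching′ : true ≡ true → TwoEarlierTouching bag′ current firstNeighbour secondNeighbour′
    two-touching′ _ with extended in e
    ... | true = two-map (λ _ → bag-old) (two-touching e)
    ... | false with anchored
    ...   | inj₁ none = ⊥-elim (none (inj₁ w-unbagged) y-bag c<current wy)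
    ...   | inj₂ (f< , y₀ , by₀ , root-y₀) = record
            { f<b = f< ; s<b = c<current ; touch-s = w-touches-c
            ; touch-f = touching root y₀ (bag-old root-bag) (bag-old by₀) root-y₀
            ; f≢s = λ f≡c → untouched (touching root y₀ root-bag (subst (λ b → bag y₀ ≡ just b) f≡c by₀) root-y₀)
            }

    old-target≢c : ∀ {x} → bag x ≡ just current → role x ≡ A → target x ≢ c
    old-target≢c bx r eq = untouched (subst (Touching G bag current) eq (touch-τ (proj₂ (A-vertices bx r))))
      where open ThreeEarlierTouching

    A-injective′ : ∀ {x x′} → bag′ x ≡ just current → bag′ x′ ≡ just current → role′ x ≡ A → role′ x′ ≡ A →
                   target′ x ≡ target′ x′ → x ≡ x′
    A-injective′ bx bx′ r r′ same with bag′-current bx | bag′-current bx′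
    ... | inj₁ (j , p) | inj₁ (j′ , p′) with A-on-path p r | A-on-path p′ r′
    ...   | _ , refl | _ , refl = geodesic-injective d w w-dist p p′
    A-injective′ bx bx′ r r′ same | inj₁ (j , p) | inj₂ (p′ , b′) =
      ⊥-elim (old-target≢c b′ (trans (sym (role-off p′)) r′)
                              (trans (sym (target-off p′)) (trans (sym same) (target-on p))))
    A-injective′ bx bx′ r r′ same | inj₂ (p , b) | inj₁ (j′ , p′) =
      ⊥-elim (old-target≢c b (trans (sym (role-off p)) r)
                             (trans (sym (target-off p)) (trans same (target-on p′))))
    A-injective′ bx bx′ r r′ same | inj₂ (p , b) | inj₂ (p′ , b′) =
      A-injective b b′ (trans (sym (role-off p)) r) (trans (sym (role-off p′)) r′)
                  (trans (sym (target-off p)) (trans same (target-off p′)))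

    path-or-bag⇒bag′ : ∀ {z} → OnGeodesic d w z ⊎ bag z ≡ just current → bag′ z ≡ just current
    path-or-bag⇒bag′ (inj₁ (_ , p)) = relabel-on _ bag p
    path-or-bag⇒bag′ (inj₂ bz) = bag-old bz

    to-root′ : ∀ {x} → bag′ x ≡ just current → Reach G (λ z → bag′ z ≡ just current) x root
    to-root′ {x} bx with bag′-current bx
    ... | inj₂ (_ , b) = reach-map bag-old (to-root b)
    ... | inj₁ on with geodesic-to-source d w w-dist x on
    ...   | s₀ , s₀-bag , r = reach-++ (reach-map path-or-bag⇒bag′ r) (reach-map bag-old (to-root s₀-bag))

    bag≤current′ : ∀ {x c′} → bag′ x ≡ just c′ → c′ ≤ current
    bag≤current′ {x} bx with on? x
    ... | inj₁ (_ , p) = ≤-reflexive (Maybeₚ.just-injective (trans (sym bx) (relabel-on _ bag p)))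
    ... | inj₂ off = bag≤current (trans (sym (relabel-off _ bag off)) bx)

    avail-clique′ : ∀ {u u′ y y′ c c′} → Reach G (Avail bag′ current) u u′ →
                    adj G u y ≡ true → adj G u′ y′ ≡ true → bag′ y ≡ just c → bag′ y′ ≡ just c′ →
                    c < current → c′ < current → c ≡ c′ ⊎ Touching G bag′ c c′
    avail-clique′ r uy u′y′ by by′ c<o c′<o =
      map₂ touch′ (avail-clique (reach-map avail′⇒avail r) uy u′y′
                                (bag′-below c<o by) (bag′-below c′<o by′) c<o c′<o)

    anchored′ : NoEarlierNeighbour bag′ current ⊎
                (firstNeighbour < current × ∃ λ y → bag′ y ≡ just firstNeighbour × adj G root y ≡ true)
    anchored′ with anchored
    ... | inj₁ none = inj₁ λ au by c<o uy → none (avail′⇒avail au) (bag′-below c<o by) c<o uy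
    ... | inj₂ (f< , y₀ , by₀ , root-y₀) = inj₂ (f< , y₀ , bag-old by₀ , root-y₀)

    grown : Growing
    grown = record
      { labelling = L′ ; current = current ; root = root ; extended = true
      ; firstNeighbour = firstNeighbour ; secondNeighbour = secondNeighbour′
      ; bag≤current = bag≤current′
      ; complete = λ c′<o → complete-transport c′<o agree (complete c′<o)
      ; avail-clique = avail-clique′
      ; root-bag = bag-old root-bag
      ; root-B = trans (role-off (bagged⇒off root-bag)) root-B
      ; to-root = to-root′ ; proper = proper′ ; singleton = λ () ; two-touching = two-touching′
      ; A-vertices = A-vertices′ ; A-injective = A-injective′ ; anchored = anchored′ }

    fewer-unbagged : unbagged bag′ < unbagged bag
    fewer-unbagged = card-< _ _ shrink w (cong is-nothing (relabel-on _ bag w-on)) (cong is-nothing w-unbagged)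
      where
      shrink : ∀ x → is-nothing (bag′ x) ≡ true → is-nothing (bag x) ≡ true
      shrink x nx with on? x
      ... | inj₁ (_ , p) = cong is-nothing (on⇒unbagged p)
      ... | inj₂ off = trans (cong is-nothing (sym (relabel-off _ bag off))) nx

  touching? : ∀ (bag : V → Maybe ℕ) c c′ → Dec (Touching G bag c c′)
  touching? bag c c′ =
    map′ (λ { (z , z′ , bz , bz′ , zz′) → touching z z′ bz bz′ zz′ })
         (λ { (touching z z′ bz bz′ zz′) → z , z′ , bz , bz′ , zz′ })
         (Finₚ.any? λ z → Finₚ.any? λ z′ →
            (bag z ≟ₘ just c) ×-dec (bag z′ ≟ₘ just c′) ×-dec (adj G z z′ ≟ᵇ true))

  Closed : Growing → Set
  Closed s = ∀ {w y c} → Search.ball s w ≡ true → bag w ≡ nothing → adj G w y ≡ true → bag y ≡ just c →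
             c < current → Touching G bag current c
    where open Growing s

  module Decide (s : Growing) where
    open Growing s
    open Search s using (ball)

    CandidateAt : V → V → Maybe ℕ → Set
    CandidateAt w y nothing = ⊥
    CandidateAt w y (just c) =
      ball w ≡ true × bag w ≡ nothing × adj G w y ≡ true × c < current × ¬ Touching G bag current c

    candidate-at? : ∀ w y b → Dec (CandidateAt w y b)
    candidate-at? w y nothing = no λ ()
    candidate-at? w y (just c) =
      (ball w ≟ᵇ true) ×-dec (bag w ≟ₘ nothing) ×-dec (adj G w y ≟ᵇ true) ×-dec
      (c <? current) ×-dec ¬? (touching? bag current c)

    candidate : ∀ w y → CandidateAt w y (bag y) → Candidate s
    candidate w y cw with bag y in by
    candidate w y (wb , bw , wy , c< , ¬t) | just c =
      record { w = w ; y = y ; c = c ; w-ball = wb ; w-unbagged = bw ; wy = wy ; y-bag = by ; c<current = c< ; untouched = ¬t }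

    extend-or-close : Candidate s ⊎ Closed s
    extend-or-close with Finₚ.any? (λ w → Finₚ.any? (λ y → candidate-at? w y (bag y)))
    ... | yes (w , y , cw) = inj₁ (candidate w y cw)
    ... | no none = inj₂ closed
      where
      closed : Closed s
      closed {w} {y} {c} wb bw wy by c< with touching? bag current c
      ... | yes t = t
      ... | no ¬t = ⊥-elim (none (w , y , subst (CandidateAt w y) (sym by) (wb , bw , wy , c< , ¬t)))

  Unbagged : (V → Maybe ℕ) → V → Set
  Unbagged bag z = bag z ≡ nothing

  record Partial : Set where
    field
      labelling : Labelling
    open Labelling labelling public
    field
      count           : ℕ
      bag<count       : ∀ {x c} → bag x ≡ just c → c < count
      complete        : ∀ {c} → c < count → Complete labelling c
      unbagged-clique : ∀ {u u′ y y′ c c′} → Reach G (Unbagged bag) u u′ →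
                        adj G u y ≡ true → adj G u′ y′ ≡ true → bag y ≡ just c → bag y′ ≡ just c′ →
                        c ≡ c′ ⊎ Touching G bag c c′

  module Close (s : Growing) (closed : Closed s) where
    open Growing s
    open Search s using (reach⇒ball)

    connected-current : BagConnected G bag current
    connected-current x x′ bx bx′ = reach-++ (to-root bx) (reach-reverse (to-root bx′))

    earlier-clique : EarlierClique G bag current
    earlier-clique c< c′< (touching x y bx by xy) (touching x′ y′ bx′ by′ x′y′) =
      avail-clique (reach-map inj₂ (connected-current x x′ bx bx′)) xy x′y′ by by′ c< c′<

    UsedIndex : Fin (suc m) → Set
    UsedIndex i = ∃ λ (c : Fin current) → index (toℕ c) ≡ i × Touching G bag current (toℕ c)

    used? : ∀ i → Dec (UsedIndex i)
    used? i = Finₚ.any? λ c → (index (toℕ c) Finₚ.≟ i) ×-dec touching? bag current (toℕ c)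

    used : ∀ {c i} → c < current → index c ≡ i → Touching G bag current c → UsedIndex i
    used {c} c< idx t rewrite sym (Finₚ.toℕ-fromℕ< c<) = fromℕ< c< , idx , t

    all-used⇒minor : (∀ i → UsedIndex i) → KMinorModel (suc (suc m)) G
    all-used⇒minor all =
      cone⇒minor G bag current g g-injective (λ i → Finₚ.toℕ<n (proj₁ (all i))) (λ i → proj₂ (proj₂ (all i)))
                 earlier-clique connected-current (λ i → Complete.connected (complete (Finₚ.toℕ<n (proj₁ (all i)))))
      where
      g : Fin (suc m) → ℕ
      g i = toℕ (proj₁ (all i))

      g-injective : Injective _≡_ _≡_ g
      g-injective {i} {j} eq = trans (sym (proj₁ (proj₂ (all i)))) (trans (cong index eq) (proj₁ (proj₂ (all j))))

    free-index : ∃ λ i → ¬ UsedIndex i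
    free-index with Finₚ.any? (λ i → ¬? (used? i))
    ... | yes free = free
    ... | no none = ⊥-elim (noMinor (all-used⇒minor (λ i → decidable-stable (used? i) (λ ¬u → none (i , ¬u)))))

    i₀ : Fin (suc m)
    i₀ = proj₁ free-index

    L′ : Labelling
    L′ = record labelling
      { index  = override _≟_ index current i₀
      ; first  = override _≟_ first current firstNeighbour
      ; second = override _≟_ second current secondNeighbour }

    below≢ : ∀ {c} → c < current → c ≢ current
    below≢ c< refl = <-irrefl refl c<

    agree : Agree current labelling L′
    agree = record
      { bag-below    = λ _ bx → bx
      ; bag-below⁻   = λ _ bx → bx
      ; role-below   = λ _ _ → refl
      ; target-below = λ _ _ → refl
      ; index-below  = λ c< → override-≢ _≟_ index current i₀ (below≢ c<)
      ; first-below  = λ c< → override-≢ _≟_ first current firstNeighbour (below≢ c<)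
      ; second-below = λ c< → override-≢ _≟_ second current secondNeighbour (below≢ c<)
      }

    complete-current : Complete L′ current
    complete-current = record
      { connected      = connected-current
      ; proper         = proper
      ; fresh-index    = fresh
      ; earlier-clique = earlier-clique
      ; A-targets      = targets
      ; A-injective    = A-injective
      }
      where
      fresh : ∀ {x y c} → bag x ≡ just current → bag y ≡ just c → c < current → adj G x y ≡ true →
              Labelling.index L′ c ≢ Labelling.index L′ current
      fresh bx by c< xy same = proj₂ free-index (used c<
        (trans (sym (override-≢ _≟_ index current i₀ (below≢ c<)))
               (trans same (override-≡ _≟_ index current i₀)))
        (touching _ _ bx by xy))

      targets : ∀ {x} → bag x ≡ just current → role x ≡ A →
                ThreeEarlierTouching bag current (target x) (Labelling.first L′ current) (Labelling.second L′ current)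
      targets bx r rewrite override-≡ _≟_ first current firstNeighbour
                         | override-≡ _≟_ second current secondNeighbour = proj₂ (A-vertices bx r)

    -- Otherwise u′ and its neighbour y would form a candidate for extending the current bag.
    touches-current : ∀ {u u′ y c′} → Reach G (Unbagged bag) u u′ →
                      (∃ λ y₀ → bag y₀ ≡ just current × adj G u y₀ ≡ true) →
                      adj G u′ y ≡ true → bag y ≡ just c′ → c′ < current → Touching G bag current c′
    touches-current r (y₀ , by₀ , uy₀) u′y by c′< =
      closed (reach⇒ball by₀ (step (inj₂ by₀) (adj-sym G uy₀) (reach-map inj₁ r))) (reach-last r) u′y by c′<

    unbagged-clique : ∀ {u u′ y y′ c c′} → Reach G (Unbagged bag) u u′ →
                      adj G u y ≡ true → adj G u′ y′ ≡ true → bag y ≡ just c → bag y′ ≡ just c′ →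
                      c ≡ c′ ⊎ Touching G bag c c′
    unbagged-clique {y = y} {y′} r uy u′y′ by by′
      with m≤n⇒m<n∨m≡n (bag≤current by) | m≤n⇒m<n∨m≡n (bag≤current by′)
    ... | inj₁ c< | inj₁ c′< = avail-clique (reach-map inj₁ r) uy u′y′ by by′ c< c′<
    ... | inj₂ refl | inj₁ c′< = inj₂ (touches-current r (y , by , uy) u′y′ by′ c′<)
    ... | inj₁ c< | inj₂ refl = inj₂ (touching-sym (touches-current (reach-reverse r) (y′ , by′ , u′y′) uy by c<))
    ... | inj₂ refl | inj₂ refl = inj₁ refl

    closed-partial : Partial
    closed-partial = record
      { labelling       = L′
      ; count           = suc current
      ; bag<count       = λ bx → s≤s (bag≤current bx)
      ; complete        = complete′
      ; unbagged-clique = unbagged-clique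
      }
      where
      complete′ : ∀ {c} → c < suc current → Complete L′ c
      complete′ c<s with m≤n⇒m<n∨m≡n (≤-pred c<s)
      ... | inj₁ c< = complete-transport c< agree (complete c<)
      ... | inj₂ refl = complete-current

  NoUnbaggedNeighbour : (V → Maybe ℕ) → Set
  NoUnbaggedNeighbour bag = ∀ {u y c} → bag u ≡ nothing → bag y ≡ just c → adj G u y ≡ true → ⊥

  Total : Partial → Set
  Total s = ∀ x → Partial.bag s x ≢ nothing

  Progress : ℕ → Set
  Progress μ = (Σ Growing λ g → unbagged (Growing.bag g) < μ) ⊎ Σ Partial Total

  bagged? : (b : Maybe ℕ) → Dec (∃ λ c → b ≡ just c)
  bagged? nothing = no λ ()
  bagged? (just c) = yes (c , refl)

  module Opening (s : Partial) where
    open Partial s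

    module At (v : V) (v-unbagged : bag v ≡ nothing) (f : ℕ)
              (anchor : NoUnbaggedNeighbour bag ⊎ (f < count × ∃ λ y → bag y ≡ just f × adj G v y ≡ true)) where

      bag′ : V → Maybe ℕ
      bag′ = override Finₚ._≟_ bag v (just count)

      L′ : Labelling
      L′ = record labelling { bag = bag′ ; role = override Finₚ._≟_ role v B }

      bag′-v : bag′ v ≡ just count
      bag′-v = override-≡ Finₚ._≟_ bag v (just count)

      bag′-≢ : ∀ {x} → x ≢ v → bag′ x ≡ bag x
      bag′-≢ = override-≢ Finₚ._≟_ bag v (just count)

      bagged⇒≢v : ∀ {x c} → bag x ≡ just c → x ≢ v
      bagged⇒≢v bx refl with trans (sym v-unbagged) bx
      ... | ()

      bag-old : ∀ {x c} → bag x ≡ just c → bag′ x ≡ just c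
      bag-old bx = trans (bag′-≢ (bagged⇒≢v bx)) bx

      bag′-below : ∀ {x c} → c < count → bag′ x ≡ just c → bag x ≡ just c
      bag′-below {x} c< bx with x Finₚ.≟ v
      ... | yes _ = ⊥-elim (<-irrefl (Maybeₚ.just-injective (sym bx)) c<)
      ... | no _ = bx

      bag′-count : ∀ {x} → bag′ x ≡ just count → x ≡ v
      bag′-count {x} bx with x Finₚ.≟ v
      ... | yes x≡v = x≡v
      ... | no _ = ⊥-elim (<-irrefl refl (bag<count bx))

      bag′≤count : ∀ {x c} → bag′ x ≡ just c → c ≤ count
      bag′≤count {x} bx with x Finₚ.≟ v
      ... | yes _ = ≤-reflexive (Maybeₚ.just-injective (sym bx))
      ... | no _ = <⇒≤ (bag<count bx)

      avail⇒unbagged : ∀ {z} → Avail bag′ count z → bag z ≡ nothing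
      avail⇒unbagged {z} az with z Finₚ.≟ v
      ... | yes z≡v = subst (Unbagged bag) (sym z≡v) v-unbagged
      ... | no _ with az
      ...   | inj₁ unb = unb
      ...   | inj₂ cur = ⊥-elim (<-irrefl refl (bag<count cur))

      agree : Agree count labelling L′
      agree = record
        { bag-below    = λ _ → bag-old
        ; bag-below⁻   = bag′-below
        ; role-below   = λ _ bx → override-≢ Finₚ._≟_ role v B (bagged⇒≢v bx)
        ; target-below = λ _ _ → refl
        ; index-below  = λ _ → refl
        ; first-below  = λ _ → refl
        ; second-below = λ _ → refl
        }

      anchored : NoEarlierNeighbour bag′ count ⊎ (f < count × ∃ λ y → bag′ y ≡ just f × adj G v y ≡ true)
      anchored = map (λ none au by c< uy → none (avail⇒unbagged au) (bag′-below c< by) uy)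
                     (λ { (f< , y , by , vy) → f< , y , bag-old by , vy }) anchor

      opened : Growing
      opened = record
        { labelling       = L′
        ; current         = count
        ; root            = v
        ; extended        = false
        ; firstNeighbour  = f
        ; secondNeighbour = zero  -- irrelevant until the bag is extended
        ; bag≤current     = λ {x} → bag′≤count {x}
        ; complete        = λ c< → complete-transport c< agree (complete c<)
        ; avail-clique    = λ r uy u′y′ by by′ c< c′< →
            map₂ (touching-map bag-old bag-old)
                 (unbagged-clique (reach-map avail⇒unbagged r) uy u′y′ (bag′-below c< by) (bag′-below c′< by′))
        ; root-bag        = bag′-v
        ; root-B          = override-≡ Finₚ._≟_ role v B
        ; to-root         = λ {x} bx → subst (λ x → Reach G (λ z → bag′ z ≡ just count) x v)
                                             (sym (bag′-count {x} bx)) (here bag′-v)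
        ; proper          = λ {x} {x′} bx bx′ xx′ _ →
                              ⊥-elim (loop (bag′-count {x} bx) (bag′-count {x′} bx′) xx′)
        ; singleton       = λ _ {x} → bag′-count {x}
        ; two-touching    = λ ()
        ; A-vertices      = λ {x} bx r → ⊥-elim (root-not-A (bag′-count {x} bx) r)
        ; A-injective     = λ {x} {x′} bx bx′ _ _ _ → trans (bag′-count {x} bx) (sym (bag′-count {x′} bx′))
        ; anchored        = anchored
        }
        where
        loop : ∀ {x x′} → x ≡ v → x′ ≡ v → adj G x x′ ≡ true → ⊥
        loop refl refl vv = ≡true⇒≢false vv (Graph.irrefl G v)

        root-not-A : ∀ {x} → x ≡ v → override Finₚ._≟_ role v B x ≢ A
        root-not-A refl r with trans (sym (override-≡ Finₚ._≟_ role v B)) r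
        ... | ()

      fewer-unbagged : unbagged bag′ < unbagged bag
      fewer-unbagged = card-< _ _ shrink v (cong is-nothing bag′-v) (cong is-nothing v-unbagged)
        where
        shrink : ∀ x → is-nothing (bag′ x) ≡ true → is-nothing (bag x) ≡ true
        shrink x nx with x Finₚ.≟ v
        ... | yes x≡v = cong is-nothing (subst (Unbagged bag) (sym x≡v) v-unbagged)
        ... | no _ = nx

    open-at : ∀ v → bag v ≡ nothing → ∀ f →
              NoUnbaggedNeighbour bag ⊎ (f < count × ∃ λ y → bag y ≡ just f × adj G v y ≡ true) →
              Progress (unbagged bag)
    open-at v bv f anchor = inj₁ (At.opened v bv f anchor , At.fewer-unbagged v bv f anchor)

    next : Progress (unbagged bag)
    next with Finₚ.any? (λ u → Finₚ.any? λ y → (bag u ≟ₘ nothing) ×-dec (adj G u y ≟ᵇ true) ×-dec bagged? (bag y))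
    ... | yes (u , y , bu , uy , c , by) = open-at u bu c (inj₂ (bag<count by , y , by , uy))
    ... | no none with Finₚ.any? (λ u → bag u ≟ₘ nothing)
    ...   | yes (u , bu) = open-at u bu zero (inj₁ λ {u} {y} {c} bu by uy → none (u , y , bu , uy , c , by))
    ...   | no all-bagged = inj₂ (s , λ x bx → all-bagged (x , bx))

  advance : (s : Growing) → Progress (unbagged (Growing.bag s))
  advance s with Decide.extend-or-close s
  ... | inj₁ cand = inj₁ (Extend.grown s cand , Extend.fewer-unbagged s cand)
  ... | inj₂ closed = Opening.next (Close.closed-partial s closed)

  empty : Partial
  empty = record
    { labelling = record { bag = λ _ → nothing ; role = λ _ → B ; target = λ _ → zero ; index = λ _ → zero
                         ; first = λ _ → zero ; second = λ _ → zero }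
    ; count = zero
    ; bag<count = λ ()
    ; complete = λ ()
    ; unbagged-clique = λ _ _ _ () }

  partition : Σ Partial Total
  partition with Opening.next empty
  ... | inj₂ done = done
  ... | inj₁ (g , _) = iterate (λ s → unbagged (Growing.bag s)) advance g

double≡ : ∀ n → n + n ≡ 2 * suc n ∸ 2
double≡ n = begin
  n + n             ≡⟨ cong (n +_) (sym (+-identityʳ n)) ⟩
  n + (n + 0)       ≡⟨ cong (_∸ 1) (sym (+-suc n (n + 0))) ⟩
  2 * suc n ∸ 2     ∎
  where open ≡-Reasoning

parity : Role → Fin m → Fin m ⊎ Fin m
parity C = inj₂
parity _ = inj₁

parity-injective : ∀ {r r′} {i j : Fin m} → r ≢ A → r′ ≢ A → parity r i ≡ parity r′ j → r ≡ r′ × i ≡ j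
parity-injective {r = A} r≢A _ _ = ⊥-elim (r≢A refl)
parity-injective {r′ = A} _ r′≢A _ = ⊥-elim (r′≢A refl)
parity-injective {r = B} {B} _ _ refl = refl , refl
parity-injective {r = C} {C} _ _ refl = refl , refl
parity-injective {r = B} {C} _ _ ()
parity-injective {r = C} {B} _ _ ()

module Colouring (G : Graph) (k : ℕ) (noMinor : ¬ KMinorModel (suc (suc (suc (suc k)))) G) where

  open Bags G (suc (suc (suc k)))
  open Construction G (suc (suc k)) noMinor using (Partial; partition)

  t : ℕ
  t = suc (suc (suc (suc k)))

  Colour : Set
  Colour = Fin (t ∸ 1) ⊎ Fin (2 * t ∸ 2)

  properColour : Fin (t ∸ 1) ⊎ Fin (t ∸ 1) → Fin (2 * t ∸ 2)
  properColour = cast (double≡ (t ∸ 1)) ∘ join (t ∸ 1) (t ∸ 1)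

  properColour-injective : Injective _≡_ _≡_ properColour
  properColour-injective {i} {j} eq = begin
    i                                 ≡⟨ sym (Finₚ.splitAt-join (t ∸ 1) (t ∸ 1) i) ⟩
    splitAt (t ∸ 1) (join _ _ i)      ≡⟨ cong (splitAt (t ∸ 1)) (Finₚ.toℕ-injective join-eq) ⟩
    splitAt (t ∸ 1) (join _ _ j)      ≡⟨ Finₚ.splitAt-join (t ∸ 1) (t ∸ 1) j ⟩
    j                                 ∎
    where
    open ≡-Reasoning
    join-eq : toℕ (join (t ∸ 1) (t ∸ 1) i) ≡ toℕ (join (t ∸ 1) (t ∸ 1) j)
    join-eq = trans (sym (Finₚ.toℕ-cast _ (join _ _ i))) (trans (cong toℕ eq) (Finₚ.toℕ-cast _ (join _ _ j)))

  open Partial (proj₁ partition)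

  colourOf : Maybe ℕ → Role → Colour
  colourOf nothing _ = inj₁ zero  -- unreachable: every vertex is bagged
  colourOf (just b) A = inj₁ (index b)
  colourOf (just b) r = inj₂ (properColour (parity r (index b)))

  colour : Colouring G Colour
  colour x = colourOf (bag x) (role x)

  complete-of : ∀ {x b} → bag x ≡ just b → Complete labelling b
  complete-of bx = complete (bag<count bx)

  improper⁻ : ∀ {x a} → colour x ≡ inj₁ a → Σ ℕ λ b → bag x ≡ just b × role x ≡ A × index b ≡ a
  improper⁻ {x} eq with bag x in bx | role x
  ... | nothing | _ = ⊥-elim (proj₂ partition x bx)
  ... | just b | A = b , refl , refl , inj₁-injective eq
  improper⁻ () | just b | B
  improper⁻ () | just b | C

  proper⁻ : ∀ {x β} → colour x ≡ inj₂ β →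
            Σ ℕ λ b → bag x ≡ just b × role x ≢ A × β ≡ properColour (parity (role x) (index b))
  proper⁻ {x} eq with bag x | role x
  proper⁻ () | nothing | _
  proper⁻ () | just b | A
  ... | just b | B = b , refl , (λ ()) , sym (inj₂-injective eq)
  ... | just b | C = b , refl , (λ ()) , sym (inj₂-injective eq)

  same-index⇒same-bag : ∀ {u w b b′} → bag u ≡ just b → bag w ≡ just b′ → adj G u w ≡ true →
                        index b ≡ index b′ → b ≡ b′
  same-index⇒same-bag {b = b} {b′} bu bw uw same with <-cmp b b′
  ... | tri< b<b′ _ _ = ⊥-elim (Complete.fresh-index (complete-of bw) bw bu b<b′ (adj-sym G uw) same)
  ... | tri≈ _ b≡b′ _ = b≡b′
  ... | tri> _ _ b′<b = ⊥-elim (Complete.fresh-index (complete-of bu) bu bw b′<b uw (sym same))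

  proper-independent : ∀ u v β → colour u ≡ inj₂ β → colour v ≡ inj₂ β → ¬ (adj G u v ≡ true)
  proper-independent u v β cu cv uv with proper⁻ {u} cu | proper⁻ {v} cv
  ... | b , bu , ru , βu | b′ , bv , rv , βv
      with parity-injective ru rv (properColour-injective (trans (sym βu) βv))
  ...   | same-role , same-index with same-index⇒same-bag bu bv uv same-index
  ...     | refl = ru (Complete.proper (complete-of bu) bu bv uv same-role)

  improper-walk-in-bag : ∀ {a b u x} → Reach G (λ z → colour z ≡ inj₁ a) u x → bag u ≡ just b → bag x ≡ just b
  improper-walk-in-bag (here _) bu = bu
  improper-walk-in-bag (step cu uw r) bu with improper⁻ cu | improper⁻ (reach-head r)
  ... | _ , bu₁ , _ , i₁ | _ , bw , _ , i₂
      with same-index⇒same-bag bu₁ bw uw (trans i₁ (sym i₂)) | trans (sym bu) bu₁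
  ...   | refl | refl = improper-walk-in-bag r bw

  improper-small : ∀ v a → colour v ≡ inj₁ a → AtMost (t ∸ 4) (MonoComponent G colour v)
  improper-small v a cv (f , f-injective , f-in) =
    noMinor (cone⇒minor G bag b g g-injective g<b g-touch earlier-clique connected
                        (λ i → Complete.connected (complete (<-trans (g<b i) (bag<count bv)))))
    where
    b : ℕ
    b = proj₁ (improper⁻ cv)

    bv : bag v ≡ just b
    bv = proj₁ (proj₂ (improper⁻ cv))

    open Complete (complete-of bv)

    walk : ∀ i → Reach G (λ z → colour z ≡ inj₁ a) v (f i)
    walk i = subst (λ c → Reach G (λ z → colour z ≡ c) v (f i)) cv (f-in i)

    f-bag : ∀ i → bag (f i) ≡ just b
    f-bag i = improper-walk-in-bag (walk i) bv

    f-A : ∀ i → role (f i) ≡ A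
    f-A i = proj₁ (proj₂ (proj₂ (improper⁻ (reach-last (walk i)))))

    three : ∀ i → ThreeEarlierTouching bag b (target (f i)) (first b) (second b)
    three i = A-targets (f-bag i) (f-A i)

    open TwoEarlierTouching (ThreeEarlierTouching.two (three zero))
    open ThreeEarlierTouching using (τ<b; touch-τ; τ≢f; τ≢s)

    g : Fin (suc (suc (suc k))) → ℕ
    g = first b ∷ᶠ second b ∷ᶠ (target ∘ f)

    g-injective : Injective _≡_ _≡_ g
    g-injective = ∷-injective _ _ (∷-injective _ _ targets-injective (λ i → τ≢s (three i))) ≢first
      where
      targets-injective : Injective _≡_ _≡_ (target ∘ f)
      targets-injective {i} {j} eq = f-injective (A-injective (f-bag i) (f-bag j) (f-A i) (f-A j) eq)

      ≢first : ∀ i → (second b ∷ᶠ (target ∘ f)) i ≢ first b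
      ≢first zero = f≢s ∘ sym
      ≢first (suc i) = τ≢f (three i)

    g<b : ∀ i → g i < b
    g<b zero = f<b
    g<b (suc zero) = s<b
    g<b (suc (suc i)) = τ<b (three i)

    g-touch : ∀ i → Touching G bag b (g i)
    g-touch zero = touch-f
    g-touch (suc zero) = touch-s
    g-touch (suc (suc i)) = touch-τ (three i)

corollary13 : (t : ℕ) → 4 ≤ t → (G : Graph) → ¬ HasKMinor t G →
    Σ (Colouring G (Fin (t ∸ 1) ⊎ Fin (2 * t ∸ 2))) λ c →
      (∀ v a → c v ≡ inj₁ a → AtMost (t ∸ 4) (MonoComponent G c v))
      × (∀ u v b → c u ≡ inj₂ b → c v ≡ inj₂ b → ¬ (adj G u v ≡ true))
corollary13 (suc (suc (suc (suc k)))) (s≤s (s≤s (s≤s (s≤s z≤n)))) G noMinor =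
  colour , improper-small , proper-independent
  where open Colouring G k noMinor
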